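{- Let $T$ be a tree with vertices $v_1,\dots,v_n$ and let $B_T=(L_T+I_n)^{ -1}=[b_{ij}]$. Then \[ b_{ii}\ge \frac{1}{\sum_{j=1}^n 2^{ -d(v_i,v_j)}}\qquad (1\le i\le n), \] where $d(v_i,v_j)$ is the number of edges of the unique $v_iv_j$-path in $T$ (so $d(v_i,v_i)=0$).
   Context: $L_T=D-A$ is the Laplacian matrix of $T$ ($A$ adjacency matrix, $D$ diagonal matrix of degrees), with row/column $i$ corresponding to vertex $v_i$; $L_T+I_n$ is positive definite, hence invertible. -}

module Defs where

open import Data.Nat using (ℕ; zero; suc)
open import Data.Fin using (Fin; zero; suc; _≟_)
open import Data.Bool using (Bool; true; false; if_then_else_)
open import Data.List using (List; []; _∷_; length)
open import Data.List.Relation.Unary.Unique.Propositional using (Unique)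
open import Data.Product using (Σ; _×_; _,_)
open import Relation.Binary.PropositionalEquality using (_≡_; _≢_)
open import Relation.Nullary using (yes; no; does)
open import Data.Rational using (ℚ; 0ℚ; 1ℚ; _+_; _*_; -_; ½; 1/_; ≢-nonZero)
import Data.Rational.Properties as ℚP

record Graph (n : ℕ) : Set where
  field
    adj     : Fin n → Fin n → Bool
    irrefl  : ∀ i → adj i i ≡ false
    sym     : ∀ i j → adj i j ≡ adj j i
open Graph public

data Walk {n : ℕ} (G : Graph n) : Fin n → Fin n → Set where
  here : ∀ {u} → Walk G u u
  step : ∀ {u w v} → adj G u w ≡ true → Walk G w v → Walk G u v

vertices : ∀ {n} {G : Graph n} {u v} → Walk G u v → List (Fin n)
vertices {u = u} here = u ∷ []
vertices {u = u} (step _ p) = u ∷ vertices p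

walkLength : ∀ {n} {G : Graph n} {u v} → Walk G u v → ℕ
walkLength here = 0
walkLength (step _ p) = suc (walkLength p)

IsPath : ∀ {n} {G : Graph n} {u v} → Walk G u v → Set
IsPath p = Unique (vertices p)

record IsTree {n : ℕ} (G : Graph n) : Set where
  field
    connected : ∀ u v → Σ (Walk G u v) IsPath
    unique    : ∀ {u v} (p q : Walk G u v) → IsPath p → IsPath q → vertices p ≡ vertices q

dist : ∀ {n} {G : Graph n} → IsTree G → Fin n → Fin n → ℕ
dist T u v with IsTree.connected T u v
... | p , _ = walkLength p

sumF : ∀ {n} → (Fin n → ℚ) → ℚ
sumF {zero}  f = 0ℚ
sumF {suc n} f = f zero + sumF (λ i → f (suc i))

b2q : Bool → ℚ
b2q true  = 1ℚ
b2q false = 0ℚ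

degree : ∀ {n} → Graph n → Fin n → ℚ
degree G i = sumF (λ j → b2q (adj G i j))

laplacian : ∀ {n} → Graph n → Fin n → Fin n → ℚ
laplacian G i j = if does (i ≟ j) then degree G i else - b2q (adj G i j)

identity : ∀ {n} → Fin n → Fin n → ℚ
identity i j = if does (i ≟ j) then 1ℚ else 0ℚ

_+ᴹ_ : ∀ {n} → (Fin n → Fin n → ℚ) → (Fin n → Fin n → ℚ) → Fin n → Fin n → ℚ
(A +ᴹ B) i j = A i j + B i j

_*ᴹ_ : ∀ {n} → (Fin n → Fin n → ℚ) → (Fin n → Fin n → ℚ) → Fin n → Fin n → ℚ
(A *ᴹ B) i j = sumF (λ k → A i k * B k j)

IsInverse : ∀ {n} → (Fin n → Fin n → ℚ) → (Fin n → Fin n → ℚ) → Set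
IsInverse M B = (∀ i j → (M *ᴹ B) i j ≡ identity i j) × (∀ i j → (B *ᴹ M) i j ≡ identity i j)

halfPow : ℕ → ℚ
halfPow zero    = 1ℚ
halfPow (suc k) = ½ * halfPow k

-- reciprocal (with the harmless convention 1/0 = 0; only applied to positive numbers here)
recip : ℚ → ℚ
recip q with q Data.Rational.≟ 0ℚ
... | yes _  = 0ℚ
... | no q≢0 = 1/_ q {{≢-nonZero q≢0}}

{-# OPTIONS --safe #-}
-- Let y be row i of B. Then y (L + I) = eᵢ, i.e. y = eᵢ + Δy with
-- (Δy)ⱼ = Σₖ aⱼₖ (yₖ − yⱼ). Summing over j gives Σ y = 1, and a minimum
-- principle gives y ≥ 0. The heart of the proof is a weighted maximum
-- principle: z = y · 2^d(i,·) is maximal at i. At a maximiser w ≠ i of z,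
-- every neighbour k of w other than its parent p (the next vertex on the
-- path to i) lies farther from i, so zₖ ≤ z_w forces yₖ ≤ y_w; the equation
-- at w then gives 2 y_w ≤ y_p, i.e. z_w ≤ z_p, and climbing towards i shows
-- z ≤ yᵢ. Hence 1 = Σ_v y_v ≤ yᵢ Σ_v 2^(−d(i,v)).
module Submission where

open import Defs renaming (sym to adj-sym; irrefl to adj-irrefl)
open import Data.Nat using (ℕ; zero; suc)
open import Data.Nat.Properties using (suc-injective)
open import Data.Fin using (Fin; zero; suc; _≟_)
import Data.Fin.Properties as Finₚ
open import Data.Bool using (true; false)
open import Data.Maybe using (just)
open import Data.Maybe.Properties using (just-injective)
open import Data.List using (_∷_; _++_; [_]; length; reverse; allFin; head)
open import Data.List.Properties using (∷-injectiveʳ; unfold-reverse)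
open import Data.List.Relation.Unary.All using (All; []; _∷_; lookup)
open import Data.List.Relation.Unary.All.Properties using (¬Any⇒All¬)
open import Data.List.Relation.Unary.AllPairs using ([]; _∷_)
open import Data.List.Relation.Unary.Any using (here; there)
open import Data.List.Relation.Unary.Unique.Propositional using (Unique)
import Data.List.Relation.Binary.Permutation.Setoid as Permutation
import Data.List.Relation.Binary.Permutation.Setoid.Properties as Permutationₚ
open import Data.List.Membership.Propositional using (_∈_)
open import Data.List.Membership.Propositional.Properties using (∈-allFin)
import Data.List.Membership.DecPropositional as DecMembership
import Data.List.Extrema as Extrema
open import Data.Product using (Σ-syntax; _,_; proj₁; proj₂)
open import Data.Empty using (⊥-elim)
open import Function using (_∘_)
open import Relation.Nullary using (yes; no)
open import Relation.Binary.Bundles using (DecTotalOrder)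
open import Relation.Binary.PropositionalEquality
  using (_≡_; _≢_; refl; sym; trans; cong; cong₂; subst; setoid; module ≡-Reasoning)
open import Data.Rational
  using (ℚ; 0ℚ; 1ℚ; ½; _+_; _*_; -_; _-_; _≤_; Positive; NonNegative; nonNegative; ≢-nonZero)
import Data.Rational as ℚ
open import Data.Rational.Properties hiding (_≟_)
open import Data.Rational.Solver using (module +-*-Solver)
open +-*-Solver using (solve; _:=_; con; _:+_; _:*_; _:-_; :-_)

0≤1 : 0ℚ ≤ 1ℚ
0≤1 = nonNegative⁻¹ 1ℚ

*-nonNeg : ∀ {p q} → 0ℚ ≤ p → 0ℚ ≤ q → 0ℚ ≤ p * q
*-nonNeg {p} {q} 0≤p 0≤q =
  nonNegative⁻¹ (p * q) {{nonNeg*nonNeg⇒nonNeg p {{nonNegative 0≤p}} q {{nonNegative 0≤q}}}}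

p≤q⇒0≤q-p : ∀ {p q} → p ≤ q → 0ℚ ≤ q - p
p≤q⇒0≤q-p {p} {q} p≤q = subst (_≤ q - p) (+-inverseʳ p) (+-monoˡ-≤ (- p) p≤q)

p≤q⇒p-q≤0 : ∀ {p q} → p ≤ q → p - q ≤ 0ℚ
p≤q⇒p-q≤0 {p} {q} p≤q = subst (p - q ≤_) (+-inverseʳ q) (+-monoˡ-≤ (- q) p≤q)

p≤p+q : ∀ p {q} → 0ℚ ≤ q → p ≤ p + q
p≤p+q p 0≤q = subst (_≤ p + _) (+-identityʳ p) (+-monoʳ-≤ p 0≤q)

recip-≤ : ∀ {q b} → 0ℚ ≤ q → 1ℚ ≤ q * b → recip q ≤ b
recip-≤ {q} {b} 0≤q 1≤qb with q ℚ.≟ 0ℚ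
... | yes refl = ⊥-elim (<-irrefl refl (<-≤-trans (positive⁻¹ 1ℚ) (subst (1ℚ ≤_) (*-zeroˡ b) 1≤qb)))
... | no q≢0 = *-cancelˡ-≤-pos q {{q-pos}} (subst (_≤ q * b) (sym (*-inverseʳ q)) 1≤qb)
  where
  instance
    q-nonZero : ℚ.NonZero q
    q-nonZero = ≢-nonZero q≢0
  q-pos : Positive q
  q-pos = nonNeg∧nonZero⇒pos q {{nonNegative 0≤q}}

module _ {n : ℕ} where
  open Extrema (DecTotalOrder.totalOrder ≤-decTotalOrder)

  minimiser : (f : Fin n → ℚ) → Fin n → Σ[ m ∈ Fin n ] (∀ u → f m ≤ f u)
  minimiser f u₀ = argmin f u₀ (allFin n) , λ u → lookup (f[argmin]≤f[xs] u₀ (allFin n)) (∈-allFin u)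

  maximiser : (f : Fin n → ℚ) → Fin n → Σ[ m ∈ Fin n ] (∀ u → f u ≤ f m)
  maximiser f u₀ = argmax f u₀ (allFin n) , λ u → lookup (f[xs]≤f[argmax] u₀ (allFin n)) (∈-allFin u)

sumF-cong : ∀ {n} {f g : Fin n → ℚ} → (∀ k → f k ≡ g k) → sumF f ≡ sumF g
sumF-cong {zero}  f≗g = refl
sumF-cong {suc n} f≗g = cong₂ _+_ (f≗g zero) (sumF-cong (f≗g ∘ suc))

sumF-zero : ∀ {n} {f : Fin n → ℚ} → (∀ k → f k ≡ 0ℚ) → sumF f ≡ 0ℚ
sumF-zero {zero}  f≗0 = refl
sumF-zero {suc n} f≗0 = cong₂ _+_ (f≗0 zero) (sumF-zero (f≗0 ∘ suc))

sumF-+ : ∀ {n} (f g : Fin n → ℚ) → sumF (λ k → f k + g k) ≡ sumF f + sumF g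
sumF-+ {zero}  f g = refl
sumF-+ {suc n} f g = trans (cong ((f zero + g zero) +_) (sumF-+ (f ∘ suc) (g ∘ suc)))
                           (interchange (f zero) (g zero) (sumF (f ∘ suc)) (sumF (g ∘ suc)))
  where
  interchange : ∀ a b c d → (a + b) + (c + d) ≡ (a + c) + (b + d)
  interchange = solve 4 (λ a b c d → (a :+ b) :+ (c :+ d) := (a :+ c) :+ (b :+ d)) refl

sumF-- : ∀ {n} (f g : Fin n → ℚ) → sumF (λ k → f k - g k) ≡ sumF f - sumF g
sumF-- {zero}  f g = refl
sumF-- {suc n} f g = trans (cong ((f zero - g zero) +_) (sumF-- (f ∘ suc) (g ∘ suc)))
                           (interchange (f zero) (g zero) (sumF (f ∘ suc)) (sumF (g ∘ suc)))
  where
  interchange : ∀ a b c d → (a - b) + (c - d) ≡ (a + c) - (b + d)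
  interchange = solve 4 (λ a b c d → (a :- b) :+ (c :- d) := (a :+ c) :- (b :+ d)) refl

sumF-*ˡ : ∀ {n} (c : ℚ) (f : Fin n → ℚ) → sumF (λ k → c * f k) ≡ c * sumF f
sumF-*ˡ {zero}  c f = sym (*-zeroʳ c)
sumF-*ˡ {suc n} c f = trans (cong (c * f zero +_) (sumF-*ˡ c (f ∘ suc)))
                            (sym (*-distribˡ-+ c (f zero) (sumF (f ∘ suc))))

sumF-comm : ∀ {m n} (f : Fin m → Fin n → ℚ) →
            sumF (λ j → sumF (λ k → f j k)) ≡ sumF (λ k → sumF (λ j → f j k))
sumF-comm {zero}  {n} f = sym (sumF-zero {n} (λ _ → refl))
sumF-comm {suc m}     f = trans (cong (sumF (f zero) +_) (sumF-comm (f ∘ suc)))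
                                (sym (sumF-+ (f zero) (λ k → sumF (λ j → f (suc j) k))))

sumF-identity : ∀ {n} (j : Fin n) (f : Fin n → ℚ) → sumF (λ k → identity j k * f k) ≡ f j
sumF-identity {suc n} zero f =
  trans (cong₂ _+_ (*-identityˡ (f zero)) (sumF-zero (λ k → *-zeroˡ (f (suc k)))))
        (+-identityʳ (f zero))
sumF-identity {suc n} (suc j) f =
  trans (cong₂ _+_ (*-zeroˡ (f zero)) (sumF-identity j (f ∘ suc))) (+-identityˡ (f (suc j)))

sumF-mono : ∀ {n} {f g : Fin n → ℚ} → (∀ k → f k ≤ g k) → sumF f ≤ sumF g
sumF-mono {zero}  f≤g = ≤-refl
sumF-mono {suc n} f≤g = +-mono-≤ (f≤g zero) (sumF-mono (f≤g ∘ suc))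

sumF-nonNeg : ∀ {n} {f : Fin n → ℚ} → (∀ k → 0ℚ ≤ f k) → 0ℚ ≤ sumF f
sumF-nonNeg {n} {f} 0≤f = subst (_≤ sumF f) (sumF-zero {n} (λ _ → refl)) (sumF-mono 0≤f)

sumF-≤-term : ∀ {n} {f : Fin n → ℚ} (j : Fin n) → (∀ k → k ≢ j → f k ≤ 0ℚ) → sumF f ≤ f j
sumF-≤-term {suc n} {f} zero f≤0 = begin
  f zero + sumF (f ∘ suc) ≤⟨ +-monoʳ-≤ (f zero) rest≤0 ⟩
  f zero + 0ℚ             ≡⟨ +-identityʳ (f zero) ⟩
  f zero                  ∎
  where
  open ≤-Reasoning
  rest≤0 : sumF (f ∘ suc) ≤ 0ℚ
  rest≤0 = subst (sumF (f ∘ suc) ≤_) (sumF-zero {n} (λ _ → refl)) (sumF-mono (λ k → f≤0 (suc k) λ ()))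
sumF-≤-term {suc n} {f} (suc j) f≤0 = begin
  f zero + sumF (f ∘ suc) ≤⟨ +-mono-≤ (f≤0 zero λ ()) rest≤ ⟩
  0ℚ + f (suc j)          ≡⟨ +-identityˡ (f (suc j)) ⟩
  f (suc j)               ∎
  where
  open ≤-Reasoning
  rest≤ : sumF (f ∘ suc) ≤ f (suc j)
  rest≤ = sumF-≤-term j (λ k k≢j → f≤0 (suc k) (k≢j ∘ Finₚ.suc-injective))

identity-sym : ∀ {n} (i j : Fin n) → identity i j ≡ identity j i
identity-sym i j with i ≟ j | j ≟ i
... | yes _   | yes _   = refl
... | no _    | no _    = refl
... | yes i≡j | no j≢i  = ⊥-elim (j≢i (sym i≡j))
... | no i≢j  | yes j≡i = ⊥-elim (i≢j (sym j≡i))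

identity-nonNeg : ∀ {n} (i j : Fin n) → 0ℚ ≤ identity i j
identity-nonNeg i j with i ≟ j
... | yes _ = 0≤1
... | no _  = ≤-refl

identity-off : ∀ {n} {i j : Fin n} → i ≢ j → identity i j ≡ 0ℚ
identity-off {i = i} {j} i≢j with i ≟ j
... | yes i≡j = ⊥-elim (i≢j i≡j)
... | no _    = refl

sumF-identity-row : ∀ {n} (i : Fin n) → sumF (identity i) ≡ 1ℚ
sumF-identity-row i = trans (sumF-cong (λ k → sym (*-identityʳ (identity i k))))
                            (sumF-identity i (λ _ → 1ℚ))

-- The screened Poisson equation on a graph

adjacency : ∀ {n} → Graph n → Fin n → Fin n → ℚ
adjacency G j k = b2q (adj G j k)

-- Δ G is −L, and ScreenedPoisson G e y is the equation y (L + I) = e.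
Δ : ∀ {n} → Graph n → (Fin n → ℚ) → Fin n → ℚ
Δ G y j = sumF (λ k → adjacency G j k * (y k - y j))

ScreenedPoisson : ∀ {n} → Graph n → (Fin n → ℚ) → (Fin n → ℚ) → Set
ScreenedPoisson G e y = ∀ j → y j ≡ e j + Δ G y j

b2q-nonNeg : ∀ b → 0ℚ ≤ b2q b
b2q-nonNeg true  = 0≤1
b2q-nonNeg false = ≤-refl

b2q-*-nonPos : ∀ {p} b → (b ≡ true → p ≤ 0ℚ) → b2q b * p ≤ 0ℚ
b2q-*-nonPos {p} true  p≤0 = subst (_≤ 0ℚ) (sym (*-identityˡ p)) (p≤0 refl)
b2q-*-nonPos {p} false _   = ≤-reflexive (*-zeroˡ p)

module _ {n : ℕ} (G : Graph n) where

  adjacency-sym : ∀ j k → adjacency G j k ≡ adjacency G k j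
  adjacency-sym j k = cong b2q (adj-sym G j k)

  L+I-entry : ∀ k j → (laplacian G +ᴹ identity) k j ≡ identity k j * (1ℚ + degree G k) - adjacency G k j
  L+I-entry k j with k ≟ j
  ... | yes refl rewrite adj-irrefl G k = diagonal (degree G k)
    where
    diagonal : ∀ d → d + 1ℚ ≡ 1ℚ * (1ℚ + d) - 0ℚ
    diagonal = solve 1 (λ d → d :+ con 1ℚ := con 1ℚ :* (con 1ℚ :+ d) :- con 0ℚ) refl
  ... | no _ = off-diagonal (degree G k) (adjacency G k j)
    where
    off-diagonal : ∀ d a → - a + 0ℚ ≡ 0ℚ * (1ℚ + d) - a
    off-diagonal = solve 2 (λ d a → :- a :+ con 0ℚ := con 0ℚ :* (con 1ℚ :+ d) :- a) refl

  Δ-expand : ∀ y j → Δ G y j ≡ sumF (λ k → adjacency G j k * y k) - y j * degree G j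
  Δ-expand y j = begin
    sumF (λ k → adjacency G j k * (y k - y j))
      ≡⟨ sumF-cong (λ k → distrib (adjacency G j k) (y k) (y j)) ⟩
    sumF (λ k → adjacency G j k * y k - y j * adjacency G j k)
      ≡⟨ sumF-- (λ k → adjacency G j k * y k) (λ k → y j * adjacency G j k) ⟩
    sumF (λ k → adjacency G j k * y k) - sumF (λ k → y j * adjacency G j k)
      ≡⟨ cong (λ s → sumF (λ k → adjacency G j k * y k) - s) (sumF-*ˡ (y j) (adjacency G j)) ⟩
    sumF (λ k → adjacency G j k * y k) - y j * degree G j ∎
    where
    open ≡-Reasoning
    distrib : ∀ a p q → a * (p - q) ≡ a * p - q * a
    distrib = solve 3 (λ a p q → a :* (p :- q) := a :* p :- q :* a) refl

  y[L+I]≡y-Δy : ∀ y j → sumF (λ k → y k * (laplacian G +ᴹ identity) k j) ≡ y j - Δ G y j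
  y[L+I]≡y-Δy y j = begin
    sumF (λ k → y k * (laplacian G +ᴹ identity) k j)
      ≡⟨ sumF-cong entry ⟩
    sumF (λ k → identity j k * (y k * (1ℚ + degree G k)) - adjacency G j k * y k)
      ≡⟨ sumF-- (λ k → identity j k * (y k * (1ℚ + degree G k))) (λ k → adjacency G j k * y k) ⟩
    sumF (λ k → identity j k * (y k * (1ℚ + degree G k))) - A
      ≡⟨ cong (_- A) (sumF-identity j (λ k → y k * (1ℚ + degree G k))) ⟩
    y j * (1ℚ + degree G j) - A
      ≡⟨ regroup (y j) (degree G j) A ⟩
    y j - (A - y j * degree G j)
      ≡⟨ cong (λ s → y j - s) (Δ-expand y j) ⟨
    y j - Δ G y j ∎
    where
    open ≡-Reasoning
    A = sumF (λ k → adjacency G j k * y k)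
    rearrange : ∀ p δ c a → p * (δ * c - a) ≡ δ * (p * c) - a * p
    rearrange = solve 4 (λ p δ c a → p :* (δ :* c :- a) := δ :* (p :* c) :- a :* p) refl
    regroup : ∀ p d s → p * (1ℚ + d) - s ≡ p - (s - p * d)
    regroup = solve 3 (λ p d s → p :* (con 1ℚ :+ d) :- s := p :- (s :- p :* d)) refl
    entry : ∀ k → y k * (laplacian G +ᴹ identity) k j
                ≡ identity j k * (y k * (1ℚ + degree G k)) - adjacency G j k * y k
    entry k = begin
      y k * (laplacian G +ᴹ identity) k j
        ≡⟨ cong (y k *_) (L+I-entry k j) ⟩
      y k * (identity k j * (1ℚ + degree G k) - adjacency G k j)
        ≡⟨ cong₂ (λ δ a → y k * (δ * (1ℚ + degree G k) - a)) (identity-sym k j) (adjacency-sym k j) ⟩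
      y k * (identity j k * (1ℚ + degree G k) - adjacency G j k)
        ≡⟨ rearrange (y k) (identity j k) (1ℚ + degree G k) (adjacency G j k) ⟩
      identity j k * (y k * (1ℚ + degree G k)) - adjacency G j k * y k ∎

  sumF-Δ≡0 : ∀ y → sumF (Δ G y) ≡ 0ℚ
  sumF-Δ≡0 y = begin
    sumF (Δ G y)
      ≡⟨ sumF-cong (Δ-expand y) ⟩
    sumF (λ j → sumF (λ k → adjacency G j k * y k) - y j * degree G j)
      ≡⟨ sumF-- (λ j → sumF (λ k → adjacency G j k * y k)) (λ j → y j * degree G j) ⟩
    sumF (λ j → sumF (λ k → adjacency G j k * y k)) - sumF (λ j → y j * degree G j)
      ≡⟨ cong (_- sumF (λ j → y j * degree G j)) double-count ⟩
    sumF (λ j → y j * degree G j) - sumF (λ j → y j * degree G j)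
      ≡⟨ +-inverseʳ (sumF (λ j → y j * degree G j)) ⟩
    0ℚ ∎
    where
    open ≡-Reasoning
    double-count : sumF (λ j → sumF (λ k → adjacency G j k * y k)) ≡ sumF (λ k → y k * degree G k)
    double-count = trans (sumF-comm (λ j k → adjacency G j k * y k)) (sumF-cong λ k →
      trans (sumF-cong (λ j → trans (cong (_* y k) (adjacency-sym j k)) (*-comm (adjacency G k j) (y k))))
            (sumF-*ˡ (y k) (adjacency G k)))

  row-of-left-inverse : ∀ (B : Fin n → Fin n → ℚ) →
                        (∀ i j → (B *ᴹ (laplacian G +ᴹ identity)) i j ≡ identity i j) →
                        ∀ i → ScreenedPoisson G (identity i) (B i)
  row-of-left-inverse B B[L+I]≡I i j = trans (split (B i j) (Δ G (B i) j))
    (cong (_+ Δ G (B i) j) (trans (sym (y[L+I]≡y-Δy (B i) j)) (B[L+I]≡I i j)))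
    where
    split : ∀ p q → p ≡ (p - q) + q
    split = solve 2 (λ p q → p := (p :- q) :+ q) refl

  ScreenedPoisson-sum : ∀ {e y} → ScreenedPoisson G e y → sumF y ≡ sumF e
  ScreenedPoisson-sum {e} {y} y≡e+Δy = begin
    sumF y                        ≡⟨ sumF-cong y≡e+Δy ⟩
    sumF (λ j → e j + Δ G y j)    ≡⟨ sumF-+ e (Δ G y) ⟩
    sumF e + sumF (Δ G y)         ≡⟨ cong (sumF e +_) (sumF-Δ≡0 y) ⟩
    sumF e + 0ℚ                   ≡⟨ +-identityʳ (sumF e) ⟩
    sumF e                        ∎
    where open ≡-Reasoning

  -- The minimum principle: at a minimiser m every term of Δ G y m is ≥ 0.
  ScreenedPoisson-nonNeg : ∀ {e y} → ScreenedPoisson G e y → (∀ j → 0ℚ ≤ e j) → ∀ j → 0ℚ ≤ y j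
  ScreenedPoisson-nonNeg {e} {y} y≡e+Δy 0≤e j with minimiser y j
  ... | m , m-min = ≤-trans 0≤y[m] (m-min j)
    where
    0≤y[m] : 0ℚ ≤ y m
    0≤y[m] = subst (0ℚ ≤_) (sym (y≡e+Δy m)) (+-mono-≤ (0≤e m) (sumF-nonNeg (λ k →
      *-nonNeg (b2q-nonNeg (adj G m k)) (p≤q⇒0≤q-p (m-min k)))))

module _ {n : ℕ} {G : Graph n} where

  length-vertices : ∀ {u v} (p : Walk G u v) → length (vertices p) ≡ suc (walkLength p)
  length-vertices here       = refl
  length-vertices (step _ p) = cong suc (length-vertices p)

  head-vertices : ∀ {u v} (p : Walk G u v) → head (vertices p) ≡ just u
  head-vertices here       = refl
  head-vertices (step _ _) = refl

  source-unique : ∀ {u u′ v} (p : Walk G u v) (q : Walk G u′ v) → vertices p ≡ vertices q → u ≡ u′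
  source-unique p q eq =
    just-injective (trans (sym (head-vertices p)) (trans (cong head eq) (head-vertices q)))

  snoc : ∀ {u v w} → Walk G u v → adj G v w ≡ true → Walk G u w
  snoc here        e = step e here
  snoc (step e′ p) e = step e′ (snoc p e)

  vertices-snoc : ∀ {u v w} (p : Walk G u v) (e : adj G v w ≡ true) →
                  vertices (snoc p e) ≡ vertices p ++ [ w ]
  vertices-snoc here           e = refl
  vertices-snoc {u} (step _ p) e = cong (u ∷_) (vertices-snoc p e)

  walkLength-snoc : ∀ {u v w} (p : Walk G u v) (e : adj G v w ≡ true) →
                    walkLength (snoc p e) ≡ suc (walkLength p)
  walkLength-snoc here       e = refl
  walkLength-snoc (step _ p) e = cong suc (walkLength-snoc p e)

  reverseWalk : ∀ {u v} → Walk G u v → Walk G v u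
  reverseWalk here                   = here
  reverseWalk {u} (step {w = w} e p) = snoc (reverseWalk p) (trans (adj-sym G w u) e)

  vertices-reverse : ∀ {u v} (p : Walk G u v) → vertices (reverseWalk p) ≡ reverse (vertices p)
  vertices-reverse here                   = refl
  vertices-reverse {u} (step {w = w} e p) = begin
    vertices (snoc (reverseWalk p) (trans (adj-sym G w u) e)) ≡⟨ vertices-snoc (reverseWalk p) _ ⟩
    vertices (reverseWalk p) ++ [ u ]                         ≡⟨ cong (_++ [ u ]) (vertices-reverse p) ⟩
    reverse (vertices p) ++ [ u ]                             ≡⟨ unfold-reverse u (vertices p) ⟨
    reverse (u ∷ vertices p)                                  ∎
    where open ≡-Reasoning

  walkLength-reverse : ∀ {u v} (p : Walk G u v) → walkLength (reverseWalk p) ≡ walkLength p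
  walkLength-reverse here       = refl
  walkLength-reverse (step e p) =
    trans (walkLength-snoc (reverseWalk p) _) (cong suc (walkLength-reverse p))

  IsPath-reverse : ∀ {u v} (p : Walk G u v) → IsPath p → IsPath (reverseWalk p)
  IsPath-reverse p p-path =
    subst Unique (sym (vertices-reverse p)) (Unique-resp-↭ (↭-sym (↭-reverse (vertices p))) p-path)
    where
    open Permutation (setoid (Fin n)) using (↭-sym)
    open Permutationₚ (setoid (Fin n)) using (Unique-resp-↭; ↭-reverse)

  suffix : ∀ {u v x} (p : Walk G u v) → x ∈ vertices p → Walk G x v
  suffix here       (here refl) = here
  suffix (step e p) (here refl) = step e p
  suffix (step _ p) (there x∈p) = suffix p x∈p

  All-suffix : ∀ {P : Fin n → Set} {u v x} (p : Walk G u v) (x∈p : x ∈ vertices p) →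
               All P (vertices p) → All P (vertices (suffix p x∈p))
  All-suffix here       (here refl) ps       = ps
  All-suffix (step _ _) (here refl) ps       = ps
  All-suffix (step _ p) (there x∈p) (_ ∷ ps) = All-suffix p x∈p ps

  IsPath-suffix : ∀ {u v x} (p : Walk G u v) (x∈p : x ∈ vertices p) → IsPath p → IsPath (suffix p x∈p)
  IsPath-suffix here       (here refl) p-path       = p-path
  IsPath-suffix (step _ _) (here refl) p-path       = p-path
  IsPath-suffix (step _ p) (there x∈p) (_ ∷ p-path) = IsPath-suffix p x∈p p-path

-- Distances in a tree

module _ {n : ℕ} {G : Graph n} (T : IsTree G) where
  open IsTree T
  open DecMembership (_≟_ {n}) using (_∈?_)

  walkLength≡dist : ∀ {u v} (p : Walk G u v) → IsPath p → walkLength p ≡ dist T u v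
  walkLength≡dist {u} {v} p p-path with connected u v
  ... | q , q-path = suc-injective (begin
    suc (walkLength p)  ≡⟨ length-vertices p ⟨
    length (vertices p) ≡⟨ cong length (unique p q p-path q-path) ⟩
    length (vertices q) ≡⟨ length-vertices q ⟩
    suc (walkLength q)  ∎)
    where open ≡-Reasoning

  dist-refl : ∀ u → dist T u u ≡ 0
  dist-refl u = sym (walkLength≡dist here ([] ∷ []))

  dist-sym : ∀ u v → dist T u v ≡ dist T v u
  dist-sym u v = begin
    dist T u v                 ≡⟨ walkLength≡dist (reverseWalk q) (IsPath-reverse q q-path) ⟨
    walkLength (reverseWalk q) ≡⟨ walkLength-reverse q ⟩
    walkLength q               ≡⟨ walkLength≡dist q q-path ⟩
    dist T v u                 ∎
    where
    open ≡-Reasoning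
    q = proj₁ (connected v u)
    q-path = proj₂ (connected v u)

  record Parent (i v : Fin n) : Set where
    field
      parent      : Fin n
      v~parent    : adj G v parent ≡ true
      dist-parent : dist T i v ≡ suc (dist T i parent)
      dist-others : ∀ u → adj G v u ≡ true → u ≢ parent → dist T i u ≡ suc (dist T i v)

  parent-of : ∀ {i v} → i ≢ v → Parent i v
  parent-of {i} {v} i≢v with connected v i
  ... | here , _ = ⊥-elim (i≢v refl)
  ... | step {w = p} v~p P , v∉P ∷ P-path = record
    { parent      = p
    ; v~parent    = v~p
    ; dist-parent = trans (sym (walkLength≡dist-to (step v~p P) (v∉P ∷ P-path)))
                          (cong suc (walkLength≡dist-to P P-path))
    ; dist-others = others
    }
    where
    walkLength≡dist-to : ∀ {u} (q : Walk G u i) → IsPath q → walkLength q ≡ dist T i u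
    walkLength≡dist-to q q-path = trans (walkLength≡dist q q-path) (dist-sym _ i)

    -- If u ≠ p lay on the path v, p, …, i, then v, u, …, i would be a second path.
    others : ∀ u → adj G v u ≡ true → u ≢ p → dist T i u ≡ suc (dist T i v)
    others u v~u u≢p with u ∈? vertices (step v~p P)
    ... | no u∉vP =
      trans (sym (walkLength≡dist-to (step u~v (step v~p P)) (¬Any⇒All¬ _ u∉vP ∷ v∉P ∷ P-path)))
            (cong suc (walkLength≡dist-to (step v~p P) (v∉P ∷ P-path)))
      where
      u~v : adj G u v ≡ true
      u~v = trans (adj-sym G u v) v~u
    ... | yes (here refl) with () ← trans (sym v~u) (adj-irrefl G v)
    ... | yes (there u∈P) = ⊥-elim (u≢p (source-unique S P (∷-injectiveʳ same-vertices)))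
      where
      S = suffix P u∈P
      same-vertices : vertices (step v~u S) ≡ vertices (step v~p P)
      same-vertices = unique (step v~u S) (step v~p P)
        (All-suffix P u∈P v∉P ∷ IsPath-suffix P u∈P P-path) (v∉P ∷ P-path)

-- Exponential decay along a tree

pow2 : ℕ → ℚ
pow2 zero    = 1ℚ
pow2 (suc k) = pow2 k + pow2 k

pow2-pos : ∀ k → Positive (pow2 k)
pow2-pos zero    = _
pow2-pos (suc k) = pos+pos⇒pos (pow2 k) {{pow2-pos k}} (pow2 k) {{pow2-pos k}}

pow2-nonNeg : ∀ k → NonNegative (pow2 k)
pow2-nonNeg k = pos⇒nonNeg (pow2 k) {{pow2-pos k}}

halfPow-nonNeg : ∀ k → 0ℚ ≤ halfPow k
halfPow-nonNeg zero    = 0≤1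
halfPow-nonNeg (suc k) = *-nonNeg (nonNegative⁻¹ ½) (halfPow-nonNeg k)

halfPow*pow2≡1 : ∀ k → halfPow k * pow2 k ≡ 1ℚ
halfPow*pow2≡1 zero    = refl
halfPow*pow2≡1 (suc k) = trans (halve (halfPow k) (pow2 k)) (halfPow*pow2≡1 k)
  where
  halve : ∀ h p → (½ * h) * (p + p) ≡ h * p
  halve = solve 2 (λ h p → (con ½ :* h) :* (p :+ p) := h :* p) refl

module Decay {n : ℕ} {G : Graph n} (T : IsTree G) {i : Fin n} {y : Fin n → ℚ}
             (y≡eᵢ+Δy : ScreenedPoisson G (identity i) y) where

  d : Fin n → ℕ
  d = dist T i

  z : Fin n → ℚ
  z v = y v * pow2 (d v)

  y-nonNeg : ∀ v → 0ℚ ≤ y v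
  y-nonNeg = ScreenedPoisson-nonNeg G y≡eᵢ+Δy (identity-nonNeg i)

  y≡Δy-off-root : ∀ {w} → i ≢ w → y w ≡ Δ G y w
  y≡Δy-off-root {w} i≢w =
    trans (y≡eᵢ+Δy w) (trans (cong (_+ Δ G y w) (identity-off i≢w)) (+-identityˡ (Δ G y w)))

  parent-dominates : ∀ {w} (i≢w : i ≢ w) → (∀ u → z u ≤ z w) →
                     z w ≤ z (Parent.parent (parent-of T i≢w))
  parent-dominates {w} i≢w w-max = begin
    y w * pow2 (d w)                ≡⟨ cong (λ m → y w * pow2 m) dist-parent ⟩
    y w * (pow2 (d p) + pow2 (d p)) ≡⟨ double (y w) (pow2 (d p)) ⟩
    (y w + y w) * pow2 (d p)        ≤⟨ *-monoʳ-≤-nonNeg (pow2 (d p)) {{pow2-nonNeg (d p)}} 2y[w]≤y[p] ⟩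
    y p * pow2 (d p)                ∎
    where
    open Parent (parent-of T i≢w) renaming (parent to p)
    open ≤-Reasoning
    double : ∀ a b → a * (b + b) ≡ (a + a) * b
    double = solve 2 (λ a b → a :* (b :+ b) := (a :+ a) :* b) refl
    cancel : ∀ a b → (b - a) + a ≡ b
    cancel = solve 2 (λ a b → (b :- a) :+ a := b) refl

    child-below : ∀ k → adj G w k ≡ true → k ≢ p → y k ≤ y w
    child-below k w~k k≢p = *-cancelʳ-≤-pos (pow2 (d w)) {{pow2-pos (d w)}} (begin
      y k * pow2 (d w)                    ≤⟨ p≤p+q (y k * pow2 (d w)) 0≤y[k]*pow2 ⟩
      y k * pow2 (d w) + y k * pow2 (d w) ≡⟨ *-distribˡ-+ (y k) (pow2 (d w)) (pow2 (d w)) ⟨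
      y k * pow2 (suc (d w))              ≡⟨ cong (λ m → y k * pow2 m) (dist-others k w~k k≢p) ⟨
      z k                                 ≤⟨ w-max k ⟩
      z w                                 ∎)
      where
      0≤y[k]*pow2 : 0ℚ ≤ y k * pow2 (d w)
      0≤y[k]*pow2 = *-nonNeg (y-nonNeg k) (nonNegative⁻¹ (pow2 (d w)) {{pow2-nonNeg (d w)}})

    other-terms-nonPos : ∀ k → k ≢ p → adjacency G w k * (y k - y w) ≤ 0ℚ
    other-terms-nonPos k k≢p =
      b2q-*-nonPos (adj G w k) (λ w~k → p≤q⇒p-q≤0 (child-below k w~k k≢p))

    y[w]≤y[p]-y[w] : y w ≤ y p - y w
    y[w]≤y[p]-y[w] = begin
      y w                           ≡⟨ y≡Δy-off-root i≢w ⟩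
      Δ G y w                       ≤⟨ sumF-≤-term p other-terms-nonPos ⟩
      adjacency G w p * (y p - y w) ≡⟨ cong (λ b → b2q b * (y p - y w)) v~parent ⟩
      1ℚ * (y p - y w)              ≡⟨ *-identityˡ (y p - y w) ⟩
      y p - y w                     ∎

    2y[w]≤y[p] : y w + y w ≤ y p
    2y[w]≤y[p] = subst (y w + y w ≤_) (cancel (y w) (y p)) (+-monoˡ-≤ (y w) y[w]≤y[p]-y[w])

  root-dominates : ∀ k w → d w ≡ k → (∀ u → z u ≤ z w) → z w ≤ z i
  root-dominates k w _ _ with i ≟ w
  root-dominates k       w _      _     | yes refl = ≤-refl
  root-dominates zero    w d[w]≡0 _     | no i≢w
    with () ← trans (sym d[w]≡0) (Parent.dist-parent (parent-of T i≢w))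
  root-dominates (suc k) w d[w]≡k w-max | no i≢w =
    ≤-trans w≤p (root-dominates k p d[p]≡k (λ u → ≤-trans (w-max u) w≤p))
    where
    open Parent (parent-of T i≢w) renaming (parent to p)
    w≤p : z w ≤ z p
    w≤p = parent-dominates i≢w w-max
    d[p]≡k : d p ≡ k
    d[p]≡k = suc-injective (trans (sym dist-parent) d[w]≡k)

  z≤y[i] : ∀ v → z v ≤ y i
  z≤y[i] v with maximiser z v
  ... | w , w-max =
    ≤-trans (w-max v) (subst (z w ≤_) z[i]≡y[i] (root-dominates (d w) w refl w-max))
    where
    z[i]≡y[i] : z i ≡ y i
    z[i]≡y[i] = trans (cong (λ m → y i * pow2 m) (dist-refl T i)) (*-identityʳ (y i))

  decay : ∀ v → y v ≤ y i * halfPow (d v)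
  decay v = begin
    y v                                ≡⟨ *-identityʳ (y v) ⟨
    y v * 1ℚ                           ≡⟨ cong (y v *_) (halfPow*pow2≡1 (d v)) ⟨
    y v * (halfPow (d v) * pow2 (d v)) ≡⟨ reassoc (y v) (halfPow (d v)) (pow2 (d v)) ⟩
    halfPow (d v) * z v                ≤⟨ *-monoˡ-≤-nonNeg (halfPow (d v)) {{h-nonNeg}} (z≤y[i] v) ⟩
    halfPow (d v) * y i                ≡⟨ *-comm (halfPow (d v)) (y i) ⟩
    y i * halfPow (d v)                ∎
    where
    open ≤-Reasoning
    h-nonNeg : NonNegative (halfPow (d v))
    h-nonNeg = nonNegative (halfPow-nonNeg (d v))
    reassoc : ∀ a h p → a * (h * p) ≡ h * (a * p)
    reassoc = solve 3 (λ a h p → a :* (h :* p) := h :* (a :* p)) refl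

corollary3p4 : ∀ (n : ℕ) (G : Graph n) (T : IsTree G) (B : Fin n → Fin n → ℚ) →
    IsInverse (laplacian G +ᴹ identity) B →
    ∀ (i : Fin n) → recip (sumF (λ j → halfPow (dist T i j))) ≤ B i i
corollary3p4 n G T B inv i = recip-≤ (sumF-nonNeg (λ j → halfPow-nonNeg (dist T i j))) 1≤S*bᵢᵢ
  where
  open ≤-Reasoning
  y≡eᵢ+Δy : ScreenedPoisson G (identity i) (B i)
  y≡eᵢ+Δy = row-of-left-inverse G B (proj₂ inv) i
  S = sumF (λ j → halfPow (dist T i j))
  1≤S*bᵢᵢ : 1ℚ ≤ S * B i i
  1≤S*bᵢᵢ = begin
    1ℚ                                        ≡⟨ sumF-identity-row i ⟨
    sumF (identity i)                         ≡⟨ ScreenedPoisson-sum G y≡eᵢ+Δy ⟨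
    sumF (B i)                                ≤⟨ sumF-mono (Decay.decay T y≡eᵢ+Δy) ⟩
    sumF (λ j → B i i * halfPow (dist T i j)) ≡⟨ sumF-*ˡ (B i i) (λ j → halfPow (dist T i j)) ⟩
    B i i * S                                 ≡⟨ *-comm (B i i) S ⟩
    S * B i i                                 ∎
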